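{- Let $X$ be a multigraph with maximum valency $d>1$. If $d=2$, then every cohesive generalized truncation of $X$ has chromatic number $2$. If $d>2$, then for every integer $k$ with $3\leq k\leq d$ there is a cohesive generalized truncation of $X$ with chromatic number $k$.
   Context: A multigraph may have multiple edges but no loops; it is assumed to have no isolated vertices. Generalized truncation of $X$: take a matching $M_0$ with $|M_0|=|E(X)|$ (on $2|E(X)|$ new vertices) and a bijection $F:E(X)\to M_0$; for each edge $e$ of $X$ with ends $u,v$, label one end of $F(e)$ by $u$ and the other by $v$. For $v\in V(X)$, the cluster $\mathrm{cl}(v)$ is the set of vertices labelled $v$; insert an arbitrary graph $\mathrm{con}(v)$ (constituent) on $\mathrm{cl}(v)$. The result is a generalized truncation of $X$; it is cohesive if every constituent is connected. -}

module Defs where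

open import Data.Nat using (ℕ; _+_; _≤_; _<_)
open import Data.Fin using (Fin)
open import Data.Fin.Properties using (_≟_)
open import Data.Bool using (Bool; true; false; if_then_else_)
open import Data.List using (map; allFin)
open import Data.Nat.ListAction using (sum)
open import Data.Product using (Σ; ∃; _×_; _,_; proj₁; proj₂)
open import Data.Sum using (_⊎_)
open import Relation.Nullary using (¬_)
open import Relation.Nullary.Decidable using (⌊_⌋)
open import Relation.Binary.PropositionalEquality using (_≡_; _≢_)
open import Relation.Binary.Construct.Closure.ReflexiveTransitive using (Star)

record Multigraph : Set where
  field
    n        : ℕ
    m        : ℕ
    ends     : Fin m → Fin n × Fin n
    noLoop   : ∀ e → proj₁ (ends e) ≢ proj₂ (ends e)
    noIsol   : ∀ v → ∃ λ e → (proj₁ (ends e) ≡ v) ⊎ (proj₂ (ends e) ≡ v)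

module _ (X : Multigraph) where
  open Multigraph X

  valency : Fin n → ℕ
  valency v = sum (map (λ e → (if ⌊ proj₁ (ends e) ≟ v ⌋ then 1 else 0)
                              + (if ⌊ proj₂ (ends e) ≟ v ⌋ then 1 else 0))
                       (allFin m))

  MaxValency : ℕ → Set
  MaxValency d = (∃ λ v → valency v ≡ d) × (∀ v → valency v ≤ d)

  -- vertices of a generalized truncation: the two ends of the matching
  -- edge F(e), for each edge e of X.
  TVert : Set
  TVert = Fin m × Bool

  label : TVert → Fin n
  label (e , false) = proj₁ (ends e)
  label (e , true)  = proj₂ (ends e)

  -- a generalized truncation is determined by the constituents, i.e. by a
  -- (simple) graph on each cluster; we record their union as one relation
  -- relating only vertices of the same cluster.
  record GenTrunc : Set₁ where
    field
      con       : TVert → TVert → Set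
      con-sym   : ∀ {a b} → con a b → con b a
      con-irr   : ∀ {a} → ¬ con a a
      con-clust : ∀ {a b} → con a b → label a ≡ label b

  TAdj : GenTrunc → TVert → TVert → Set
  TAdj T a b = ((proj₁ a ≡ proj₁ b) × (proj₂ a ≢ proj₂ b)) ⊎ GenTrunc.con T a b

  Cohesive : GenTrunc → Set
  Cohesive T = ∀ v a b → label a ≡ v → label b ≡ v → Star (GenTrunc.con T) a b

Colourable : (V : Set) → (V → V → Set) → ℕ → Set
Colourable V Adj k = Σ (V → Fin k) λ c → ∀ a b → Adj a b → c a ≢ c b

ChromaticNumber : (V : Set) → (V → V → Set) → ℕ → Set
ChromaticNumber V Adj k = Colourable V Adj k × (∀ j → j < k → ¬ Colourable V Adj j)

-- For d = 2 every cluster has at most two darts, so the truncation is the union of two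
-- matchings: the edges F(e), and the pairs of darts sharing a cluster. Such a graph is
-- bipartite; a 2-colouring is found by contracting the edges F(e) one at a time.
-- For 3 ≤ k ≤ d, take w of valency d, put on cl(w) a complete multipartite graph with k
-- nonempty classes (so it contains K_k and k colours are needed) and a star on every other
-- cluster; outside cl(w) three colours suffice, colouring hubs before leaves.

module Submission where

open import Defs
open import Algebra.Definitions using (Involutive)
open import Data.Bool using (Bool; true; false; not; _xor_; if_then_else_)
open import Data.Bool.Properties using (not-involutive; not-¬) renaming (_≟_ to _≟ᵇ_)
open import Data.Empty using (⊥-elim)
open import Data.Fin using (Fin; zero; suc; toℕ; fromℕ<) renaming (_<_ to _<ᶠ_)
open import Data.Fin.Properties using (_≟_; pigeonhole; toℕ<n; toℕ-fromℕ<; 2↔Bool)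
open import Data.List using (tabulate)
open import Data.List.Properties using (map-tabulate)
open import Data.Nat using (ℕ; zero; suc; _+_; _≤_; _<_; z≤n; s≤s; _∸_; _⊓_; pred)
open import Data.Nat.ListAction using (sum)
open import Data.Nat.Properties as ℕ using ()
open import Data.Product using (Σ; ∃; _×_; _,_; proj₁; proj₂)
open import Data.Product.Properties using (≡-dec)
open import Data.Sum using (inj₁; inj₂)
open import Function using (_∘_; id)
open import Function.Bundles using (Inverse)
open import Relation.Binary.Construct.Closure.ReflexiveTransitive using (Star; ε; _◅_; _◅◅_; reverse)
open import Relation.Binary.Definitions using (DecidableEquality)
open import Relation.Binary.PropositionalEquality
open import Relation.Nullary using (¬_; yes; no)
open import Relation.Nullary.Decidable using (⌊_⌋)

prefixSum : ∀ {m} → (Fin m → ℕ) → Fin m → ℕ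
prefixSum s zero    = 0
prefixSum s (suc e) = s zero + prefixSum (s ∘ suc) e

prefixSum<sum : ∀ {m} (s : Fin m → ℕ) e → 0 < s e → prefixSum s e < sum (tabulate s)
prefixSum<sum s zero    0<s = ℕ.≤-trans 0<s (ℕ.m≤m+n _ _)
prefixSum<sum s (suc e) 0<s = ℕ.+-monoʳ-< (s zero) (prefixSum<sum (s ∘ suc) e 0<s)

prefixSum-injective : ∀ {m} (s : Fin m → ℕ) {e e'} → 0 < s e → 0 < s e' →
                      prefixSum s e ≡ prefixSum s e' → e ≡ e'
prefixSum-injective s {zero}  {zero}   _   _   _  = refl
prefixSum-injective s {zero}  {suc _}  0<s _   eq = ⊥-elim (ℕ.<⇒≢ 0<s (sym (ℕ.m+n≡0⇒m≡0 _ (sym eq))))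
prefixSum-injective s {suc _} {zero}   _   0<s eq = ⊥-elim (ℕ.<⇒≢ 0<s (sym (ℕ.m+n≡0⇒m≡0 _ eq)))
prefixSum-injective s {suc _} {suc _}  0<s 0<s' eq =
  cong suc (prefixSum-injective (s ∘ suc) 0<s 0<s' (ℕ.+-cancelˡ-≡ (s zero) _ _ eq))

prefixSum-suc : ∀ {m} (s : Fin (suc m) → ℕ) {x j} → s zero ≡ x →
                (∃ λ e → s (suc e) ≡ 1 × prefixSum (s ∘ suc) e ≡ j) →
                ∃ λ e → s e ≡ 1 × prefixSum s e ≡ x + j
prefixSum-suc s s₀ (e , se , pe) = suc e , se , cong₂ _+_ s₀ pe

prefixSum-surjective : ∀ {m} (s : Fin m → ℕ) → (∀ e → s e ≤ 1) → ∀ j → j < sum (tabulate s) →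
                       ∃ λ e → s e ≡ 1 × prefixSum s e ≡ j
prefixSum-surjective {suc m} s s≤1 zero j<sum with s zero in s₀ | s≤1 zero
... | 0           | _     = prefixSum-suc s s₀ (prefixSum-surjective (s ∘ suc) (s≤1 ∘ suc) zero j<sum)
... | 1           | _     = zero , s₀ , refl
... | suc (suc _) | s≤s ()
prefixSum-surjective {suc m} s s≤1 (suc j) j<sum with s zero in s₀ | s≤1 zero
... | 0           | _     = prefixSum-suc s s₀ (prefixSum-surjective (s ∘ suc) (s≤1 ∘ suc) (suc j) j<sum)
... | 1           | _     = prefixSum-suc s s₀ (prefixSum-surjective (s ∘ suc) (s≤1 ∘ suc) j (ℕ.≤-pred j<sum))
... | suc (suc _) | s≤s ()

Dart : ℕ → Set
Dart m = Fin m × Bool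

opposite : ∀ {m} → Dart m → Dart m
opposite (e , b) = e , not b

record IsProperColouring {m} (g : Dart m → Dart m) (c : Dart m → Bool) : Set where
  field
    opposite-proper : ∀ a → c (opposite a) ≢ c a
    involution-proper : ∀ a → g a ≢ a → c (g a) ≢ c a

xor-cancelʳ : ∀ x y t → x xor t ≡ y xor t → x ≡ y
xor-cancelʳ false false t _  = refl
xor-cancelʳ true  true  t _  = refl
xor-cancelʳ false true  t eq = ⊥-elim (not-¬ refl eq)
xor-cancelʳ true  false t eq = ⊥-elim (not-¬ refl (sym eq))

not-≢ : ∀ b → not b ≢ b
not-≢ b = not-¬ refl ∘ sym

module Contraction {m} (g : Dart (suc m) → Dart (suc m)) (g-involutive : Involutive _≡_ g) where

  lift : Dart m → Dart (suc m)
  lift (e , b) = suc e , b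

  g-swap : ∀ {a b} → g a ≡ b → g b ≡ a
  g-swap {a} refl = g-involutive a

  across : Dart (suc m) → Dart (suc m)
  across (zero  , b) = g (zero , not b)
  across (suc e , b) = suc e , b

  -- Walking from x along g, through the edge zero if need be, ends at far x.
  far : Dart m → Dart (suc m)
  far x = across (g (lift x))

  far-swap : ∀ x y → far x ≡ lift y → far y ≡ lift x
  far-swap (e , b) (e' , b') eq with g (suc e , b) in gx
  ... | suc _ , _ = cong across (g-swap (trans gx eq))
  ... | zero  , c = begin
    across (g (suc e' , b'))  ≡⟨ cong across (g-swap eq) ⟩
    g (zero , not (not c))    ≡⟨ cong (λ z → g (zero , z)) (not-involutive c) ⟩
    g (zero , c)              ≡⟨ g-swap gx ⟩
    suc e , b                 ∎
    where open ≡-Reasoning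

  lower : Dart (suc m) → Dart m → Dart m
  lower (zero  , _) x = x
  lower (suc e , b) _ = e , b

  contract : Dart m → Dart m
  contract x = lower (far x) x

  contract-lift : ∀ {x y} → far x ≡ lift y → contract x ≡ y
  contract-lift {x} {_ , _} eq = cong (λ a → lower a x) eq

  contract-stuck : ∀ {x b} → far x ≡ (zero , b) → contract x ≡ x
  contract-stuck {x} eq = cong (λ a → lower a x) eq

  contract-involutive : Involutive _≡_ contract
  contract-involutive x with far x in fx
  ... | zero  , _ = contract-stuck fx
  ... | suc e , b = contract-lift (far-swap x (e , b) fx)

  module Extension (c : Dart m → Bool) (proper : IsProperColouring contract c) where
    open IsProperColouring proper

    anchorFrom : Dart (suc m) → Dart (suc m) → Bool
    anchorFrom (suc e , b) _           = not (c (e , b))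
    anchorFrom (zero  , _) (suc e , b) = c (e , b)
    anchorFrom (zero  , _) (zero  , _) = false

    anchor : Bool
    anchor = anchorFrom (g (zero , false)) (g (zero , true))

    extend : Dart (suc m) → Bool
    extend (zero  , b) = b xor anchor
    extend (suc e , b) = c (e , b)

    -- If both ends of the edge zero have neighbours outside it, these are adjacent under contract.
    extend-zero : ∀ b x → g (zero , b) ≡ lift x → c x ≢ b xor anchor
    extend-zero false (e , b) gx h = not-¬ refl (trans h (cong (λ a → anchorFrom a (g (zero , true))) gx))
    extend-zero true  x       gx with g (zero , false) in g₀
    ... | zero  , s = λ h → not-¬ refl (trans h (cong not (cong (anchorFrom (zero , s)) gx)))
    ... | suc e , b = λ h → involution-proper (e , b) contract≢
                              (trans (cong c contract≡) (trans h (not-involutive _)))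
      where
      contract≡ : contract (e , b) ≡ x
      contract≡ = contract-lift (trans (cong across (g-swap g₀)) gx)
      contract≢ : contract (e , b) ≢ (e , b)
      contract≢ eq with () ← cong proj₂ (trans (sym (g-swap gx))
                               (trans (cong (g ∘ lift) (trans (sym contract≡) eq)) (g-swap g₀)))

    extend-proper : IsProperColouring g extend
    extend-proper = record { opposite-proper = opposite≢ ; involution-proper = g≢ }
      where
      opposite≢ : ∀ a → extend (opposite a) ≢ extend a
      opposite≢ (zero  , b) = not-≢ b ∘ xor-cancelʳ (not b) b anchor
      opposite≢ (suc e , b) = opposite-proper (e , b)

      g≢ : ∀ a → g a ≢ a → extend (g a) ≢ extend a
      g≢ (zero , b) ga≢a with g (zero , b) in ga
      ... | zero  , b' = ga≢a ∘ cong (zero ,_) ∘ xor-cancelʳ b' b anchor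
      ... | suc e , b' = extend-zero b (e , b') ga
      g≢ (suc e , b) ga≢a with g (suc e , b) in ga
      ... | zero  , b' = extend-zero b' (e , b) (g-swap ga) ∘ sym
      ... | suc e' , b' = subst (λ y → c y ≢ c (e , b)) contract≡
                            (involution-proper (e , b) (ga≢a ∘ cong lift ∘ trans (sym contract≡)))
        where
        contract≡ : contract (e , b) ≡ (e' , b')
        contract≡ = contract-lift (cong across ga)

twoColouring : ∀ m (g : Dart m → Dart m) → Involutive _≡_ g → Σ (Dart m → Bool) (IsProperColouring g)
twoColouring zero    g _ =
  (λ _ → false) , record { opposite-proper = λ { (() , _) } ; involution-proper = λ { (() , _) } }
twoColouring (suc m) g g-involutive =
  let open Contraction g g-involutive
      c , proper = twoColouring m contract contract-involutive
      open Extension c proper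
  in extend , extend-proper

matching-proper : ∀ {m} {C : Set} (c : Dart m → C) → (∀ e → c (e , false) ≢ c (e , true)) →
                  ∀ {a b} → proj₁ a ≡ proj₁ b → proj₂ a ≢ proj₂ b → c a ≢ c b
matching-proper c proper {_ , false} {_ , false} refl ≢ = ⊥-elim (≢ refl)
matching-proper c proper {e , false} {_ , true}  refl _ = proper e
matching-proper c proper {e , true}  {_ , false} refl _ = proper e ∘ sym
matching-proper c proper {_ , true}  {_ , true}  refl ≢ = ⊥-elim (≢ refl)

module _ {V : Set} {Adj : V → V → Set} where

  clique⇒¬Colourable : ∀ {k} (f : Fin k → V) → (∀ {i i'} → i <ᶠ i' → Adj (f i) (f i')) →
                       ∀ j → j < k → ¬ Colourable V Adj j
  clique⇒¬Colourable f adjacent j j<k (c , proper) =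
    let i , i' , i<i' , same = pigeonhole j<k (c ∘ f) in proper _ _ (adjacent i<i') same

  edge⇒¬Colourable : ∀ {a b} → Adj a b → ∀ j → j < 2 → ¬ Colourable V Adj j
  edge⇒¬Colourable {a} {b} adj = clique⇒¬Colourable endpoint adjacent
    where
    endpoint : Fin 2 → V
    endpoint zero    = a
    endpoint (suc _) = b
    adjacent : ∀ {i i'} → i <ᶠ i' → Adj (endpoint i) (endpoint i')
    adjacent {zero}     {suc _}    _        = adj
    adjacent {suc zero} {suc zero} (s≤s ())

  colourable-ℕ : ∀ {k} (c : V → ℕ) → (∀ a → c a < k) → (∀ a b → Adj a b → c a ≢ c b) → Colourable V Adj k
  colourable-ℕ c c<k proper = (λ a → fromℕ< (c<k a)) , λ a b adj same →
    proper a b adj (trans (sym (toℕ-fromℕ< (c<k a))) (trans (cong toℕ same) (toℕ-fromℕ< (c<k b))))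

-- the least of 0, 1, 2 different from both arguments
avoid : ℕ → ℕ → ℕ
avoid (suc _)    (suc _)    = 0
avoid zero       (suc zero) = 2
avoid (suc zero) zero       = 2
avoid zero       _          = 1
avoid _          zero       = 1

avoid-≢ˡ : ∀ x y → avoid x y ≢ x
avoid-≢ˡ (suc _)          (suc _)          ()
avoid-≢ˡ zero             (suc zero)       ()
avoid-≢ˡ (suc zero)       zero             ()
avoid-≢ˡ zero             zero             ()
avoid-≢ˡ zero             (suc (suc _))    ()
avoid-≢ˡ (suc (suc _))    zero             ()

avoid-≢ʳ : ∀ x y → avoid x y ≢ y
avoid-≢ʳ (suc _)          (suc _)          ()
avoid-≢ʳ zero             (suc zero)       ()
avoid-≢ʳ (suc zero)       zero             ()
avoid-≢ʳ zero             zero             ()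
avoid-≢ʳ zero             (suc (suc _))    ()
avoid-≢ʳ (suc (suc _))    zero             ()

avoid<3 : ∀ x y → avoid x y < 3
avoid<3 (suc _)          (suc _)          = s≤s z≤n
avoid<3 zero             (suc zero)       = ℕ.≤-refl
avoid<3 (suc zero)       zero             = ℕ.≤-refl
avoid<3 zero             zero             = s≤s (s≤s z≤n)
avoid<3 zero             (suc (suc _))    = s≤s (s≤s z≤n)
avoid<3 (suc (suc _))    zero             = s≤s (s≤s z≤n)

module Clusters (X : Multigraph) where
  open Multigraph X

  incidence : Fin n → Fin m → ℕ
  incidence v e = (if ⌊ proj₁ (ends e) ≟ v ⌋ then 1 else 0) + (if ⌊ proj₂ (ends e) ≟ v ⌋ then 1 else 0)

  valency≡sum : ∀ v → valency X v ≡ sum (tabulate (incidence v))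
  valency≡sum v = cong sum (map-tabulate id (incidence v))

  incidence≤1 : ∀ v e → incidence v e ≤ 1
  incidence≤1 v e with proj₁ (ends e) ≟ v | proj₂ (ends e) ≟ v
  ... | yes p | yes q = ⊥-elim (noLoop e (trans p (sym q)))
  ... | yes _ | no _  = ℕ.≤-refl
  ... | no _  | yes _ = ℕ.≤-refl
  ... | no _  | no _  = z≤n

  dartAt : Fin n → Fin m → TVert X
  dartAt v e with proj₁ (ends e) ≟ v
  ... | yes _ = e , false
  ... | no _  = e , true

  proj₁-dartAt : ∀ v e → proj₁ (dartAt v e) ≡ e
  proj₁-dartAt v e with proj₁ (ends e) ≟ v
  ... | yes _ = refl
  ... | no _  = refl

  label-dartAt : ∀ v e → incidence v e ≡ 1 → label X (dartAt v e) ≡ v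
  label-dartAt v e i≡1 with proj₁ (ends e) ≟ v
  ... | yes p = p
  ... | no _ with proj₂ (ends e) ≟ v
  ...   | yes q = q
  ...   | no _  = ⊥-elim (ℕ.0≢1+n i≡1)

  incidence-label : ∀ a → incidence (label X a) (proj₁ a) ≡ 1
  incidence-label (e , false) with proj₁ (ends e) ≟ proj₁ (ends e) | proj₂ (ends e) ≟ proj₁ (ends e)
  ... | _     | yes q = ⊥-elim (noLoop e (sym q))
  ... | yes _ | no _  = refl
  ... | no ≢  | no _  = ⊥-elim (≢ refl)
  incidence-label (e , true) with proj₁ (ends e) ≟ proj₂ (ends e) | proj₂ (ends e) ≟ proj₂ (ends e)
  ... | yes q | _     = ⊥-elim (noLoop e q)
  ... | no _  | yes _ = refl
  ... | no _  | no ≢  = ⊥-elim (≢ refl)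

  dartAt-label : ∀ a → dartAt (label X a) (proj₁ a) ≡ a
  dartAt-label (e , false) with proj₁ (ends e) ≟ proj₁ (ends e)
  ... | yes _ = refl
  ... | no ≢  = ⊥-elim (≢ refl)
  dartAt-label (e , true) with proj₁ (ends e) ≟ proj₂ (ends e)
  ... | yes q = ⊥-elim (noLoop e q)
  ... | no _  = refl

  rank : TVert X → ℕ
  rank a = prefixSum (incidence (label X a)) (proj₁ a)

  rank<valency : ∀ a → rank a < valency X (label X a)
  rank<valency a = subst (rank a <_) (sym (valency≡sum (label X a)))
    (prefixSum<sum (incidence (label X a)) (proj₁ a) (ℕ.≤-reflexive (sym (incidence-label a))))

  rank-injective : ∀ {a b} → label X a ≡ label X b → rank a ≡ rank b → a ≡ b
  rank-injective {a} {b} la≡lb ra≡rb = begin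
    a                                ≡⟨ sym (dartAt-label a) ⟩
    dartAt (label X a) (proj₁ a)     ≡⟨ cong₂ dartAt la≡lb edge≡ ⟩
    dartAt (label X b) (proj₁ b)     ≡⟨ dartAt-label b ⟩
    b                                ∎
    where
    open ≡-Reasoning
    edge≡ : proj₁ a ≡ proj₁ b
    edge≡ = prefixSum-injective (incidence (label X b))
      (ℕ.≤-reflexive (sym (subst (λ v → incidence v (proj₁ a) ≡ 1) la≡lb (incidence-label a))))
      (ℕ.≤-reflexive (sym (incidence-label b)))
      (trans (cong (λ v → prefixSum (incidence v) (proj₁ a)) (sym la≡lb)) ra≡rb)

  rank-surjective : ∀ v j → j < valency X v → ∃ λ a → label X a ≡ v × rank a ≡ j
  rank-surjective v j j<val =
    let e , i≡1 , pe = prefixSum-surjective (incidence v) (incidence≤1 v) j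
                         (subst (j <_) (valency≡sum v) j<val)
        a = dartAt v e
        la = label-dartAt v e i≡1
    in a , la , trans (cong₂ (λ u e' → prefixSum (incidence u) e') la (proj₁-dartAt v e)) pe

  _≟ᵗ_ : DecidableEquality (TVert X)
  _≟ᵗ_ = ≡-dec _≟_ _≟ᵇ_

  hub : Fin n → TVert X
  hub v with noIsol v
  ... | e , inj₁ _ = e , false
  ... | e , inj₂ _ = e , true

  label-hub : ∀ v → label X (hub v) ≡ v
  label-hub v with noIsol v
  ... | e , inj₁ p = p
  ... | e , inj₂ q = q

other-bit : ∀ {x y} → x < 2 → y < 2 → y ≢ x → y ≡ 1 ∸ x
other-bit {0} {0} _ _ ≢ = ⊥-elim (≢ refl)
other-bit {0} {1} _ _ _ = refl
other-bit {1} {0} _ _ _ = refl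
other-bit {1} {1} _ _ ≢ = ⊥-elim (≢ refl)
other-bit {suc (suc _)} (s≤s (s≤s ()))
other-bit {_} {suc (suc _)} _ (s≤s (s≤s ()))

module ValencyAtMostTwo (X : Multigraph) (valency≤2 : ∀ v → valency X v ≤ 2) where
  open Multigraph X
  open Clusters X

  -- the other dart of the cluster, or the dart itself when it is alone there
  partner : TVert X → TVert X
  partner a with 1 ∸ rank a ℕ.<? valency X (label X a)
  ... | yes r = proj₁ (rank-surjective (label X a) (1 ∸ rank a) r)
  ... | no _  = a

  label-partner : ∀ a → label X (partner a) ≡ label X a
  label-partner a with 1 ∸ rank a ℕ.<? valency X (label X a)
  ... | yes r = proj₁ (proj₂ (rank-surjective (label X a) (1 ∸ rank a) r))
  ... | no _  = refl

  rank-other : ∀ {a b} → b ≢ a → label X b ≡ label X a → rank b ≡ 1 ∸ rank a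
  rank-other {a} {b} b≢a lb≡la = other-bit (rank<2 a) (rank<2 b) (b≢a ∘ rank-injective lb≡la)
    where
    rank<2 : ∀ c → rank c < 2
    rank<2 c = ℕ.<-≤-trans (rank<valency c) (valency≤2 (label X c))

  partner-unique : ∀ {a b} → b ≢ a → label X b ≡ label X a → partner a ≡ b
  partner-unique {a} {b} b≢a lb≡la with 1 ∸ rank a ℕ.<? valency X (label X a)
  ... | yes r = let _ , lc , rc = rank-surjective (label X a) (1 ∸ rank a) r
                in rank-injective (trans lc (sym lb≡la)) (trans rc (sym (rank-other b≢a lb≡la)))
  ... | no r≮ = ⊥-elim (r≮ (subst₂ _<_ (rank-other b≢a lb≡la) (cong (valency X) lb≡la) (rank<valency b)))

  partner-involutive : Involutive _≡_ partner
  partner-involutive a with partner a ≟ᵗ a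
  ... | yes pa≡a = trans (cong partner pa≡a) pa≡a
  ... | no pa≢a = partner-unique (pa≢a ∘ sym) (sym (label-partner a))

  twoChromatic : Fin n → (T : GenTrunc X) → ChromaticNumber (TVert X) (TAdj X T) 2
  twoChromatic v T = (Inverse.from 2↔Bool ∘ c , fin-proper) , edge⇒¬Colourable across-e₀
    where
    open GenTrunc T
    colouring : Σ (TVert X → Bool) (IsProperColouring partner)
    colouring = twoColouring m partner partner-involutive
    c : TVert X → Bool
    c = proj₁ colouring
    open IsProperColouring (proj₂ colouring)

    proper : ∀ a b → TAdj X T a b → c a ≢ c b
    proper a b (inj₁ (same-edge , other-side)) =
      matching-proper c (λ e → opposite-proper (e , false) ∘ sym) same-edge other-side
    proper a b (inj₂ a~b) = involution-proper a (b≢a ∘ trans (sym partner≡b)) ∘ trans (cong c partner≡b) ∘ sym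
      where
      b≢a : b ≢ a
      b≢a refl = con-irr a~b
      partner≡b : partner a ≡ b
      partner≡b = partner-unique b≢a (sym (con-clust a~b))

    fin-proper : ∀ a b → TAdj X T a b → Inverse.from 2↔Bool (c a) ≢ Inverse.from 2↔Bool (c b)
    fin-proper a b adj same = proper a b adj
      (trans (sym (Inverse.strictlyInverseˡ 2↔Bool (c a)))
        (trans (cong (Inverse.to 2↔Bool) same) (Inverse.strictlyInverseˡ 2↔Bool (c b))))

    across-e₀ : TAdj X T (proj₁ (hub v) , false) (proj₁ (hub v) , true)
    across-e₀ = inj₁ (refl , λ ())

pred[n]<n : ∀ {k} → 0 < k → pred k < k
pred[n]<n (s≤s _) = ℕ.≤-refl

module PrescribedChromaticNumber (X : Multigraph) (w : Fin (Multigraph.n X))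
                                 (k : ℕ) (3≤k : 3 ≤ k) (k≤valency : k ≤ valency X w) where
  open Multigraph X
  open Clusters X

  -- the classes of the complete multipartite constituent on cl(w)
  class : TVert X → ℕ
  class a = rank a ⊓ pred k

  class<k : ∀ a → class a < k
  class<k a = ℕ.≤-<-trans (ℕ.m⊓n≤n (rank a) (pred k)) (pred[n]<n (ℕ.<-≤-trans (s≤s z≤n) 3≤k))

  dartOfClass : ∀ j → j < k → ∃ λ a → label X a ≡ w × class a ≡ j
  dartOfClass j j<k =
    let a , la , ra = rank-surjective w j (ℕ.<-≤-trans j<k k≤valency)
    in a , la , trans (cong (_⊓ pred k) ra) (ℕ.m≤n⇒m⊓n≡m (ℕ.<⇒≤pred j<k))

  record Spoke (h b : TVert X) : Set where
    field
      away     : label X b ≢ w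
      is-hub   : h ≡ hub (label X b)
      not-hub  : b ≢ h

  data Con (a b : TVert X) : Set where
    multipartite : label X a ≡ w → label X b ≡ w → class a ≢ class b → Con a b
    spoke-out    : Spoke a b → Con a b
    spoke-in     : Spoke b a → Con a b

  Con-sym : ∀ {a b} → Con a b → Con b a
  Con-sym (multipartite la lb ≢) = multipartite lb la (≢ ∘ sym)
  Con-sym (spoke-out s)          = spoke-in s
  Con-sym (spoke-in s)           = spoke-out s

  Con-irr : ∀ {a} → ¬ Con a a
  Con-irr (multipartite _ _ ≢) = ≢ refl
  Con-irr (spoke-out s)        = Spoke.not-hub s refl
  Con-irr (spoke-in s)         = Spoke.not-hub s refl

  Spoke-cluster : ∀ {h b} → Spoke h b → label X h ≡ label X b
  Spoke-cluster s = trans (cong (label X) (Spoke.is-hub s)) (label-hub _)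

  Con-cluster : ∀ {a b} → Con a b → label X a ≡ label X b
  Con-cluster (multipartite la lb _) = trans la (sym lb)
  Con-cluster (spoke-out s)          = Spoke-cluster s
  Con-cluster (spoke-in s)           = sym (Spoke-cluster s)

  T : GenTrunc X
  T = record { con = Con ; con-sym = Con-sym ; con-irr = Con-irr ; con-clust = Con-cluster }

  fromHub : ∀ {v} → v ≢ w → ∀ a → label X a ≡ v → Star Con (hub v) a
  fromHub v≢w a refl with a ≟ᵗ hub (label X a)
  ... | yes a≡h = subst (Star Con _) (sym a≡h) ε
  ... | no a≢h  = spoke-out (record { away = v≢w ; is-hub = refl ; not-hub = a≢h }) ◅ ε

  pivot : ∀ a → ∃ λ z → label X z ≡ w × class z ≢ class a
  pivot a with class a ℕ.≟ 0
  ... | yes c≡0 = let z , lz , cz = dartOfClass 1 (ℕ.<-≤-trans (s≤s (s≤s z≤n)) 3≤k)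
                  in z , lz , λ h → ℕ.1+n≢0 (trans (sym cz) (trans h c≡0))
  ... | no c≢0  = let z , lz , cz = dartOfClass 0 (ℕ.<-≤-trans (s≤s z≤n) 3≤k)
                  in z , lz , λ h → c≢0 (trans (sym h) cz)

  withinW : ∀ a b → label X a ≡ w → label X b ≡ w → Star Con a b
  withinW a b la lb with class a ℕ.≟ class b
  ... | no ≢   = multipartite la lb ≢ ◅ ε
  ... | yes ≡c with z , lz , z≢a ← pivot a
    = multipartite {b = z} la lz (z≢a ∘ sym) ◅ multipartite lz lb (λ h → z≢a (trans h (sym ≡c))) ◅ ε

  cohesive : Cohesive X T
  cohesive v a b la lb with v ≟ w
  ... | yes refl = withinW a b la lb
  ... | no v≢w   = reverse Con-sym (fromHub v≢w a la) ◅◅ fromHub v≢w b lb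

  data Role : Set where
    atW centre leaf : Role

  role : TVert X → Role
  role a with label X a ≟ w
  ... | yes _ = atW
  ... | no _ with a ≟ᵗ hub (label X a)
  ...   | yes _ = centre
  ...   | no _  = leaf

  role-atW : ∀ a → label X a ≡ w → role a ≡ atW
  role-atW a la with label X a ≟ w
  ... | yes _ = refl
  ... | no ≢  = ⊥-elim (≢ la)

  atW-label : ∀ a → role a ≡ atW → label X a ≡ w
  atW-label a ra with label X a ≟ w
  ... | yes la = la
  ... | no _ with a ≟ᵗ hub (label X a)
  atW-label a () | no _ | yes _
  atW-label a () | no _ | no _

  role-hub : ∀ {v} → v ≢ w → role (hub v) ≡ centre
  role-hub {v} v≢w with label X (hub v) ≟ w
  ... | yes lh = ⊥-elim (v≢w (trans (sym (label-hub v)) lh))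
  ... | no _ with hub v ≟ᵗ hub (label X (hub v))
  ...   | yes _ = refl
  ...   | no ≢  = ⊥-elim (≢ (cong hub (sym (label-hub v))))

  role-leaf : ∀ {a} → label X a ≢ w → a ≢ hub (label X a) → role a ≡ leaf
  role-leaf {a} la≢w a≢h with label X a ≟ w
  ... | yes la = ⊥-elim (la≢w la)
  ... | no _ with a ≟ᵗ hub (label X a)
  ...   | yes a≡h = ⊥-elim (a≢h a≡h)
  ...   | no _    = refl

  sideColour : Bool → ℕ
  sideColour false = 0
  sideColour true  = 1

  centreColourAs : Role → TVert X → ℕ
  centreColourAs atW    a = avoid (class (opposite a)) (class (opposite a))
  centreColourAs centre a = sideColour (proj₂ a)
  centreColourAs leaf   a = sideColour (proj₂ a)

  hubColour : TVert X → ℕ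
  hubColour a = let h = hub (label X a) in centreColourAs (role (opposite h)) h

  -- Each dart avoids the colours of the neighbours coloured before it: first the cluster of w,
  -- then the hubs (two hubs sharing an edge are told apart by their sides), then the leaves.
  colourAs : Role → Role → TVert X → ℕ
  colourAs atW    _      a           = class a
  colourAs centre r      a           = centreColourAs r a
  colourAs leaf   atW    a           = avoid (hubColour a) (class (opposite a))
  colourAs leaf   centre a           = avoid (hubColour a) (centreColourAs leaf (opposite a))
  colourAs leaf   leaf   (e , false) = avoid (hubColour (e , false)) (hubColour (e , false))
  colourAs leaf   leaf   (e , true)  = avoid (hubColour (e , true))
                                             (avoid (hubColour (e , false)) (hubColour (e , false)))

  colour : TVert X → ℕ
  colour a = colourAs (role a) (role (opposite a)) a

  colour-matching : ∀ e → colour (e , false) ≢ colour (e , true)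
  colour-matching e with role (e , false) in r₀ | role (e , true) in r₁
  ... | atW    | atW    = λ _ → noLoop e (trans (atW-label (e , false) r₀) (sym (atW-label (e , true) r₁)))
  ... | atW    | centre = avoid-≢ˡ _ _ ∘ sym
  ... | atW    | leaf   = avoid-≢ʳ _ _ ∘ sym
  ... | centre | atW    = avoid-≢ˡ _ _
  ... | centre | centre = λ ()
  ... | centre | leaf   = avoid-≢ʳ _ _ ∘ sym
  ... | leaf   | atW    = avoid-≢ʳ _ _
  ... | leaf   | centre = avoid-≢ʳ _ _
  ... | leaf   | leaf   = avoid-≢ʳ _ _ ∘ sym

  leaf-avoids-hub : ∀ r b → colourAs leaf r b ≢ hubColour b
  leaf-avoids-hub atW    _           = avoid-≢ˡ _ _
  leaf-avoids-hub centre _           = avoid-≢ˡ _ _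
  leaf-avoids-hub leaf   (_ , false) = avoid-≢ˡ _ _
  leaf-avoids-hub leaf   (_ , true)  = avoid-≢ˡ _ _

  spoke-proper : ∀ {h b} → Spoke h b → colour h ≢ colour b
  spoke-proper {h} {b} s h≡b = leaf-avoids-hub (role (opposite b)) b (begin
    colourAs leaf (role (opposite b)) b  ≡⟨ cong (λ r → colourAs r (role (opposite b)) b) (sym role-b) ⟩
    colour b                             ≡⟨ sym h≡b ⟩
    colour h                             ≡⟨ cong (λ r → colourAs r (role (opposite h)) h) role-h ⟩
    centreColourAs (role (opposite h)) h ≡⟨ cong (λ h' → centreColourAs (role (opposite h')) h') is-hub ⟩
    hubColour b                          ∎)
    where
    open Spoke s
    open ≡-Reasoning
    role-b : role b ≡ leaf
    role-b = role-leaf away (λ b≡hub → not-hub (trans b≡hub (sym is-hub)))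
    role-h : role h ≡ centre
    role-h = trans (cong role is-hub) (role-hub away)

  colour-atW : ∀ a → label X a ≡ w → colour a ≡ class a
  colour-atW a la = cong (λ r → colourAs r (role (opposite a)) a) (role-atW a la)

  colour-proper : ∀ a b → TAdj X T a b → colour a ≢ colour b
  colour-proper a b (inj₁ (same-edge , other-side)) = matching-proper colour colour-matching same-edge other-side
  colour-proper a b (inj₂ (multipartite la lb ≢)) h = ≢ (trans (sym (colour-atW a la)) (trans h (colour-atW b lb)))
  colour-proper a b (inj₂ (spoke-out s))            = spoke-proper s
  colour-proper a b (inj₂ (spoke-in s))             = spoke-proper s ∘ sym

  colour<k : ∀ a → colour a < k
  colour<k a = colourAs<k (role a) (role (opposite a)) a
    where
    below3 : ∀ {x} → x < 3 → x < k
    below3 x<3 = ℕ.<-≤-trans x<3 3≤k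
    sideColour<3 : ∀ b → sideColour b < 3
    sideColour<3 false = s≤s z≤n
    sideColour<3 true  = s≤s (s≤s z≤n)
    centreColourAs<3 : ∀ r a → centreColourAs r a < 3
    centreColourAs<3 atW    _ = avoid<3 _ _
    centreColourAs<3 centre a = sideColour<3 (proj₂ a)
    centreColourAs<3 leaf   a = sideColour<3 (proj₂ a)
    colourAs<k : ∀ r r' a → colourAs r r' a < k
    colourAs<k atW    _      a           = class<k a
    colourAs<k centre r'     a           = below3 (centreColourAs<3 r' a)
    colourAs<k leaf   atW    _           = below3 (avoid<3 _ _)
    colourAs<k leaf   centre _           = below3 (avoid<3 _ _)
    colourAs<k leaf   leaf   (_ , false) = below3 (avoid<3 _ _)
    colourAs<k leaf   leaf   (_ , true)  = below3 (avoid<3 _ _)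

  chromatic : ChromaticNumber (TVert X) (TAdj X T) k
  chromatic = colourable-ℕ colour colour<k colour-proper , clique⇒¬Colourable clique adjacent
    where
    clique : Fin k → TVert X
    clique i = proj₁ (dartOfClass (toℕ i) (toℕ<n i))
    adjacent : ∀ {i i'} → i <ᶠ i' → TAdj X T (clique i) (clique i')
    adjacent {i} {i'} i<i' =
      let _ , la , ca = dartOfClass (toℕ i) (toℕ<n i)
          _ , lb , cb = dartOfClass (toℕ i') (toℕ<n i')
      in inj₂ (multipartite la lb (λ h → ℕ.<⇒≢ i<i' (trans (sym ca) (trans h cb))))

theorem7p5 : (X : Multigraph) (d : ℕ) → MaxValency X d → 1 < d →
    (d ≡ 2 → (T : GenTrunc X) → Cohesive X T → ChromaticNumber (TVert X) (TAdj X T) 2)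
    × (2 < d → (k : ℕ) → 3 ≤ k → k ≤ d →
        Σ (GenTrunc X) (λ T → Cohesive X T × ChromaticNumber (TVert X) (TAdj X T) k))
theorem7p5 X d ((w , valency≡d) , valency≤d) _ = maxValency2 , maxValency>2
  where
  maxValency2 : d ≡ 2 → (T : GenTrunc X) → Cohesive X T → ChromaticNumber (TVert X) (TAdj X T) 2
  maxValency2 refl T _ = ValencyAtMostTwo.twoChromatic X valency≤d w T
  maxValency>2 : 2 < d → (k : ℕ) → 3 ≤ k → k ≤ d →
    Σ (GenTrunc X) (λ T → Cohesive X T × ChromaticNumber (TVert X) (TAdj X T) k)
  maxValency>2 _ k 3≤k k≤d = T , cohesive , chromatic
    where open PrescribedChromaticNumber X w k 3≤k (subst (k ≤_) (sym valency≡d) k≤d)
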